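{- Let $\mathcal{C}$ be a class of $\mathcal{L}$-frames and $\Phi\subseteq\mathsf{Form}_{\mathcal{L}}$. The following are equivalent: (i) $\mathcal{C}=\mathrm{Mod}_1(\Phi)$; (ii) there is $m>0$ with $\mathcal{C}=\mathrm{Mod}_m(\mathrm{tr}_m(\Phi))$; (iii) for every $m>0$, $\mathcal{C}=\mathrm{Mod}_m(\mathrm{tr}_m(\Phi))$. Moreover, $\mathrm{Mod}_m(\Phi)\subseteq\mathrm{Mod}_1(\Phi)$ for every $m>0$.
   Context: Let $\mathcal{L}=\{\neg,\to,1\}\cup\{\nabla_i : i\in I\}$ be a modal language, each $\nabla_i$ a $k_i$-ary connective ($k_i\ge1$); $\mathsf{Form}_{\mathcal{L}}$ is built from an infinite set $\mathsf{Prop}$ of variables by $\phi::=p\mid0\mid\neg\phi\mid\phi\to\phi\mid\nabla_i(\phi,\dots,\phi)$. Abbreviations: $p\oplus q=\neg p\to q$, $p\odot q=\neg(\neg p\oplus\neg q)$, $p^m=p\odot\cdots\odot p$ ($m$ times). $\mathrm{tr}_m(\phi(p_1,\dots,p_k))=\phi(p_1^m,\dots,p_k^m)$ (substitute $p^m$ for each variable $p$). For $m>0$, $\text{Ł}_m=\{0,\frac1m,\dots,1\}$ with $\neg x=1-x$, $x\to y=\min(1,1-x+y)$. An $\mathcal{L}$-frame is $\langle W,(R_i)_{i\in I}\rangle$, $W\ne\emptyset$, $R_i\subseteq W^{k_i+1}$; $\mathbf{w}\in R_iu$ means $(u,w_1,\dots,w_{k_i})\in R_i$. An $\text{Ł}_m$-valued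 model is $\mathrm{Val}:W\times\mathsf{Prop}\to\text{Ł}_m$ extended by Łukasiewicz operations and $\mathrm{Val}(u,\nabla_i(\phi_1,\dots,\phi_k))=\min\{\max_\ell\mathrm{Val}(w_\ell,\phi_\ell):\mathbf{w}\in R_iu\}$ (empty minimum $=1$). $\mathfrak{F}\models_m\phi$ means $\phi$ has value $1$ at all worlds of all $\text{Ł}_m$-valued models on $\mathfrak{F}$; $\mathrm{Mod}_m(\Phi)=\{\mathfrak{F}:\mathfrak{F}\models_m\phi\ \forall\phi\in\Phi\}$. -}

module Defs where

open import Data.Nat as ℕ using (ℕ; zero; suc; _∸_; _+_; _⊓_; s≤s; _≤?_)
open import Data.Nat.Properties using (m∸n≤m; m⊓n≤m)
open import Data.Fin as Fin using (Fin; toℕ; fromℕ; fromℕ<)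
open import Data.Product using (Σ; _×_; ∃)
open import Relation.Nullary using (yes; no)
open import Relation.Binary.PropositionalEquality using (_≡_)

-- Modal language L = {¬, →, 1} ∪ {∇ᵢ : i ∈ I}; ∇ᵢ has arity kᵢ = suc (ar i) ≥ 1

record Lang : Set₁ where
  field
    I  : Set
    ar : I → ℕ

module _ (L : Lang) where
  open Lang L

  -- Prop = ℕ (an infinite set of variables)
  data Form : Set where
    var  : ℕ → Form
    ⊥f   : Form
    ¬f_  : Form → Form
    _⇒_  : Form → Form → Form
    ∇    : (i : I) → (Fin (suc (ar i)) → Form) → Form

  1f : Form
  1f = ¬f ⊥f

  _⊕_ : Form → Form → Form
  p ⊕ q = (¬f p) ⇒ q

  _⊙_ : Form → Form → Form
  p ⊙ q = ¬f ((¬f p) ⊕ (¬f q))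

  -- p^m = p ⊙ ... ⊙ p (m times); only used for m > 0 (p^0 := 1)
  pow : Form → ℕ → Form
  pow p zero          = 1f
  pow p (suc zero)    = p
  pow p (suc (suc n)) = p ⊙ pow p (suc n)

  tr : ℕ → Form → Form
  tr m (var p)  = pow (var p) m
  tr m ⊥f       = ⊥f
  tr m (¬f φ)   = ¬f (tr m φ)
  tr m (φ ⇒ ψ)  = tr m φ ⇒ tr m ψ
  tr m (∇ i φs) = ∇ i (λ j → tr m (φs j))

  -- L-frames: nonempty W, R_i ⊆ W^{k_i+1};  R i u w  means  w ∈ R_i u
  record Frame : Set₁ where
    field
      W   : Set
      w₀  : W                                         -- W ≠ ∅
      R   : (i : I) → W → (Fin (suc (ar i)) → W) → Set

  -- Ł_m = {0, 1/m, ..., 1}; element j : Fin (suc m) stands for j/m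

  Ł : ℕ → Set
  Ł m = Fin (suc m)

  topŁ : (m : ℕ) → Ł m
  topŁ m = fromℕ m

  botŁ : (m : ℕ) → Ł m
  botŁ m = Fin.zero

  -- ¬x = 1 - x
  negŁ : (m : ℕ) → Ł m → Ł m
  negŁ m x = fromℕ< (s≤s (m∸n≤m m (toℕ x)))

  -- x → y = min(1, 1 - x + y)
  impŁ : (m : ℕ) → Ł m → Ł m → Ł m
  impŁ m x y = fromℕ< (s≤s (m⊓n≤m m ((m ∸ toℕ x) + toℕ y)))

  maxŁ : (m : ℕ) → Ł m → Ł m → Ł m
  maxŁ m x y with toℕ x ≤? toℕ y
  ... | yes _ = y
  ... | no  _ = x

  -- max over a finite family (empty max = 0; only used for k ≥ 1)
  maxF : (m k : ℕ) → (Fin k → Ł m) → Ł m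
  maxF m zero    f = botŁ m
  maxF m (suc k) f = maxŁ m (f Fin.zero) (maxF m k (λ j → f (Fin.suc j)))

  -- v is the infimum (= minimum, Ł_m being finite) of { f w : P w };
  -- for empty P this forces v = 1
  IsInf : (m : ℕ) {A : Set} → (A → Set) → (A → Ł m) → Ł m → Set
  IsInf m {A} P f v =
    ((w : A) → P w → v Fin.≤ f w) ×
    ((x : Ł m) → ((w : A) → P w → x Fin.≤ f w) → x Fin.≤ v)

  -- An Ł_m-valued model on F: a map Val : W × Form → Ł_m whose values on
  -- variables are arbitrary and which satisfies the Łukasiewicz / modal
  -- recursion clauses (i.e. the unique extension of Val restricted to Prop).
  record Model (m : ℕ) (F : Frame) : Set where
    open Frame F
    field
      Val   : W → Form → Ł m
      v-⊥   : ∀ u → Val u ⊥f ≡ botŁ m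
      v-¬   : ∀ u φ → Val u (¬f φ) ≡ negŁ m (Val u φ)
      v-⇒   : ∀ u φ ψ → Val u (φ ⇒ ψ) ≡ impŁ m (Val u φ) (Val u ψ)
      v-∇   : ∀ u i (φs : Fin (suc (ar i)) → Form) →
              IsInf m (R i u)
                    (λ w → maxF m (suc (ar i)) (λ ℓ → Val (w ℓ) (φs ℓ)))
                    (Val u (∇ i φs))

  Valid : (m : ℕ) → Frame → Form → Set
  Valid m F φ = (M : Model m F) → (u : Frame.W F) → Model.Val M u φ ≡ topŁ m

  Mod : (m : ℕ) → (Form → Set) → Frame → Set
  Mod m Φ F = (φ : Form) → Φ φ → Valid m F φ

  trSet : ℕ → (Form → Set) → (Form → Set)
  trSet m Φ ψ = Σ Form (λ φ → Φ φ × (ψ ≡ tr m φ))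

  _≐_ : ∀ {ℓ} → (Frame → Set ℓ) → (Frame → Set) → Set (Agda.Primitive.lsuc Agda.Primitive.lzero Agda.Primitive.⊔ ℓ)
  C ≐ D = (F : Frame) → (C F → D F) × (D F → C F)

-- In Ł₁ every power p^m equals p, so tr_m φ and φ take the same values and
-- Mod₁(tr_m Φ) = Mod₁(Φ).  In Ł_m the power p^m is 1 if p = 1 and 0
-- otherwise, so every formula tr_m φ takes only the values 0 and 1.  The
-- two-element chain Ł₁ embeds into Ł_m preserving all operations and all
-- infima; this lifts Ł₁-models to Ł_m-models (giving Mod_m Φ ⊆ Mod₁ Φ), and
-- reading the Boolean values of tr_m φ in an Ł_m-model back into Ł₁ yields
-- an Ł₁-model in which φ has those values.
module Submission where

open import Defs
open import Level using (Level)
open import Data.Nat using (ℕ; _>_)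
open import Data.Product using (Σ; _×_)
open import Function.Bundles using (_⇔_)

open import Data.Nat as ℕ using (zero; suc; pred; _∸_; _+_; _⊓_; _⊔_; _≤_; _<_; z≤n; z<s; s≤s)
open import Data.Nat.Properties
open import Data.Fin as Fin using (Fin; toℕ; fromℕ)
open import Data.Fin.Properties as Finₚ using (toℕ-injective; toℕ-fromℕ; toℕ-fromℕ<; toℕ≤pred[n]; ≤fromℕ)
open import Data.Product using (_,_; proj₁; proj₂)
open import Data.Empty using (⊥-elim)
open import Function.Base using (_∘_)
open import Function.Bundles using (Equivalence; mk⇔)
open import Function.Construct.Symmetry using (⇔-sym)
open import Relation.Nullary using (yes; no)
open import Relation.Binary.PropositionalEquality

łukasiewicz-⊙ : ∀ {m a b} → a ≤ m → b ≤ m → m ∸ (m ⊓ ((m ∸ a) + (m ∸ b))) ≡ a + b ∸ m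
łukasiewicz-⊙ {m} {a} {b} a≤m b≤m = begin
  m ∸ (m ⊓ ((m ∸ a) + (m ∸ b)))      ≡⟨ ∸-distribˡ-⊓-⊔ m m _ ⟩
  (m ∸ m) ⊔ (m ∸ ((m ∸ a) + (m ∸ b))) ≡⟨ cong (_⊔ (m ∸ ((m ∸ a) + (m ∸ b)))) (n∸n≡0 m) ⟩
  m ∸ ((m ∸ a) + (m ∸ b))            ≡⟨ ∸-+-assoc m (m ∸ a) (m ∸ b) ⟨
  m ∸ (m ∸ a) ∸ (m ∸ b)              ≡⟨ cong (_∸ (m ∸ b)) (m∸[m∸n]≡n a≤m) ⟩
  a ∸ (m ∸ b)                        ≡⟨ [m+n]∸[m+o]≡n∸o b a (m ∸ b) ⟨
  b + a ∸ (b + (m ∸ b))              ≡⟨ cong₂ _∸_ (+-comm b a) (m+[n∸m]≡n b≤m) ⟩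
  a + b ∸ m                          ∎
  where open ≡-Reasoning

m<o⇒m+n∸o≤pred[n] : ∀ {m n o} → m < o → m + n ∸ o ≤ pred n
m<o⇒m+n∸o≤pred[n] {m} {n} {o} m<o = begin
  m + n ∸ o        ≤⟨ ∸-monoʳ-≤ (m + n) m<o ⟩
  m + n ∸ suc m    ≡⟨ pred[m∸n]≡m∸[1+n] (m + n) m ⟨
  pred (m + n ∸ m) ≡⟨ cong pred (m+n∸m≡n m n) ⟩
  pred n           ∎
  where open ≤-Reasoning

module _ (L : Lang) where

  toℕ-negŁ : ∀ m (x : Ł L m) → toℕ (negŁ L m x) ≡ m ∸ toℕ x
  toℕ-negŁ m x = toℕ-fromℕ< _

  toℕ-impŁ : ∀ m (x y : Ł L m) → toℕ (impŁ L m x y) ≡ m ⊓ ((m ∸ toℕ x) + toℕ y)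
  toℕ-impŁ m x y = toℕ-fromℕ< _

  toℕ-maxŁ : ∀ m (x y : Ł L m) → toℕ (maxŁ L m x y) ≡ toℕ x ⊔ toℕ y
  toℕ-maxŁ m x y with toℕ x ℕ.≤? toℕ y
  ... | yes x≤y = sym (m≤n⇒m⊔n≡n x≤y)
  ... | no  x≰y = sym (m≥n⇒m⊔n≡m (≰⇒≥ x≰y))

  negŁ-bot : ∀ m → negŁ L m (botŁ L m) ≡ topŁ L m
  negŁ-bot m = toℕ-injective (trans (toℕ-negŁ m (botŁ L m)) (sym (toℕ-fromℕ m)))

  negŁ-top : ∀ m → negŁ L m (topŁ L m) ≡ botŁ L m
  negŁ-top m = toℕ-injective (trans (toℕ-negŁ m (topŁ L m)) (trans (cong (m ∸_) (toℕ-fromℕ m)) (n∸n≡0 m)))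

  impŁ-botˡ : ∀ m (y : Ł L m) → impŁ L m (botŁ L m) y ≡ topŁ L m
  impŁ-botˡ m y = toℕ-injective
    (trans (toℕ-impŁ m (botŁ L m) y) (trans (m≤n⇒m⊓n≡m (m≤m+n m _)) (sym (toℕ-fromℕ m))))

  impŁ-topˡ : ∀ m (y : Ł L m) → impŁ L m (topŁ L m) y ≡ y
  impŁ-topˡ m y = toℕ-injective (begin
    toℕ (impŁ L m (topŁ L m) y)        ≡⟨ toℕ-impŁ m (topŁ L m) y ⟩
    m ⊓ ((m ∸ toℕ (fromℕ m)) + toℕ y) ≡⟨ cong (λ t → m ⊓ ((m ∸ t) + toℕ y)) (toℕ-fromℕ m) ⟩
    m ⊓ ((m ∸ m) + toℕ y)             ≡⟨ cong (λ t → m ⊓ (t + toℕ y)) (n∸n≡0 m) ⟩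
    m ⊓ toℕ y                         ≡⟨ m≥n⇒m⊓n≡n (toℕ≤pred[n] y) ⟩
    toℕ y                             ∎)
    where open ≡-Reasoning

  maxŁ-botˡ : ∀ m (y : Ł L m) → maxŁ L m (botŁ L m) y ≡ y
  maxŁ-botˡ m y = toℕ-injective (toℕ-maxŁ m _ y)

  maxŁ-topˡ : ∀ m (y : Ł L m) → maxŁ L m (topŁ L m) y ≡ topŁ L m
  maxŁ-topˡ m y = toℕ-injective (trans (toℕ-maxŁ m _ y) (m≥n⇒m⊔n≡m (≤fromℕ y)))

  maxF-cong : ∀ m n {f g : Fin n → Ł L m} → (∀ j → f j ≡ g j) → maxF L m n f ≡ maxF L m n g
  maxF-cong m zero    f≗g = refl
  maxF-cong m (suc n) f≗g = cong₂ (maxŁ L m) (f≗g Fin.zero) (maxF-cong m n (f≗g ∘ Fin.suc))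

  IsInf-unique : ∀ {m A} {P : A → Set} {f : A → Ł L m} {v v′} →
                 IsInf L m P f v → IsInf L m P f v′ → v ≡ v′
  IsInf-unique (v≤f , glb) (v′≤f , glb′) = Finₚ.≤-antisym (glb′ _ v≤f) (glb _ v′≤f)

  IsInf-cong : ∀ {m A} {P : A → Set} {f g : A → Ł L m} {v v′} →
               (∀ a → f a ≡ g a) → v ≡ v′ → IsInf L m P f v → IsInf L m P g v′
  IsInf-cong f≗g refl (v≤f , glb) =
    (λ a p → subst (_ Fin.≤_) (f≗g a) (v≤f a p)) ,
    (λ x x≤g → glb x (λ a p → subst (x Fin.≤_) (sym (f≗g a)) (x≤g a p)))

  embŁ : ∀ m → Ł L 1 → Ł L m
  embŁ m Fin.zero           = botŁ L m
  embŁ m (Fin.suc Fin.zero) = topŁ L m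

  isTopŁ : ∀ m → Ł L m → Ł L 1
  isTopŁ m x with toℕ x ℕ.≟ m
  ... | yes _ = topŁ L 1
  ... | no  _ = botŁ L 1

  embŁ-isTopŁ : (x : Ł L 1) → embŁ 1 (isTopŁ 1 x) ≡ x
  embŁ-isTopŁ Fin.zero           = refl
  embŁ-isTopŁ (Fin.suc Fin.zero) = refl

  embŁ-negŁ : ∀ m b → embŁ m (negŁ L 1 b) ≡ negŁ L m (embŁ m b)
  embŁ-negŁ m Fin.zero           = sym (negŁ-bot m)
  embŁ-negŁ m (Fin.suc Fin.zero) = sym (negŁ-top m)

  embŁ-impŁ : ∀ m b c → embŁ m (impŁ L 1 b c) ≡ impŁ L m (embŁ m b) (embŁ m c)
  embŁ-impŁ m Fin.zero c =
    trans (cong (embŁ m) (impŁ-botˡ 1 c)) (sym (impŁ-botˡ m (embŁ m c)))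
  embŁ-impŁ m (Fin.suc Fin.zero) c =
    trans (cong (embŁ m) (impŁ-topˡ 1 c)) (sym (impŁ-topˡ m (embŁ m c)))

  embŁ-maxŁ : ∀ m b c → embŁ m (maxŁ L 1 b c) ≡ maxŁ L m (embŁ m b) (embŁ m c)
  embŁ-maxŁ m Fin.zero c =
    trans (cong (embŁ m) (maxŁ-botˡ 1 c)) (sym (maxŁ-botˡ m (embŁ m c)))
  embŁ-maxŁ m (Fin.suc Fin.zero) c =
    trans (cong (embŁ m) (maxŁ-topˡ 1 c)) (sym (maxŁ-topˡ m (embŁ m c)))

  embŁ-maxF : ∀ m n (f : Fin n → Ł L 1) → embŁ m (maxF L 1 n f) ≡ maxF L m n (embŁ m ∘ f)
  embŁ-maxF m zero    f = refl
  embŁ-maxF m (suc n) f =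
    trans (embŁ-maxŁ m (f Fin.zero) (maxF L 1 n (f ∘ Fin.suc))) (cong (maxŁ L m (embŁ m (f Fin.zero))) (embŁ-maxF m n (f ∘ Fin.suc)))

  embŁ-mono : ∀ m {b c} → b Fin.≤ c → embŁ m b Fin.≤ embŁ m c
  embŁ-mono m {Fin.zero}           _ = z≤n
  embŁ-mono m {Fin.suc Fin.zero} {Fin.suc Fin.zero} _ = ≤-refl

  embŁ-cancel-≤ : ∀ k {b c} → embŁ (suc k) b Fin.≤ embŁ (suc k) c → b Fin.≤ c
  embŁ-cancel-≤ k {Fin.zero}           _ = z≤n
  embŁ-cancel-≤ k {Fin.suc Fin.zero} {Fin.suc Fin.zero} _ = ≤-refl

  embŁ-injective : ∀ k {b c} → embŁ (suc k) b ≡ embŁ (suc k) c → b ≡ c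
  embŁ-injective k eq = Finₚ.≤-antisym (embŁ-cancel-≤ k (Finₚ.≤-reflexive eq))
                                       (embŁ-cancel-≤ k (Finₚ.≤-reflexive (sym eq)))

  IsInf-embŁ : ∀ m {A} {P : A → Set} {f : A → Ł L 1} {v} →
               IsInf L 1 P f v → IsInf L m P (embŁ m ∘ f) (embŁ m v)
  IsInf-embŁ m {P = P} {f} (v≤f , glb) = (λ a p → embŁ-mono m (v≤f a p)) , glb′ glb
    where
    glb′ : ∀ {v} → (∀ x → (∀ a → P a → x Fin.≤ f a) → x Fin.≤ v) →
           ∀ x → (∀ a → P a → x Fin.≤ embŁ m (f a)) → x Fin.≤ embŁ m v
    glb′ {Fin.suc Fin.zero} _   x           _   = ≤fromℕ x
    glb′ {Fin.zero}         _   Fin.zero    _   = z≤n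
    glb′ {Fin.zero}         glb (Fin.suc j) x≤f =
      ⊥-elim (1+n≰n (glb (topŁ L 1) (λ a p → top≤ (f a) (x≤f a p))))
      where
      top≤ : ∀ b → Fin.suc j Fin.≤ embŁ m b → topŁ L 1 Fin.≤ b
      top≤ (Fin.suc Fin.zero) _ = ≤-refl

  IsInf-embŁ⁻¹ : ∀ k {A} {P : A → Set} {f : A → Ł L 1} {v} →
                 IsInf L (suc k) P (embŁ (suc k) ∘ f) (embŁ (suc k) v) → IsInf L 1 P f v
  IsInf-embŁ⁻¹ k (v≤f , glb) =
    (λ a p → embŁ-cancel-≤ k (v≤f a p)) ,
    (λ x x≤f → embŁ-cancel-≤ k (glb (embŁ (suc k) x) (λ a p → embŁ-mono (suc k) (x≤f a p))))

  IsBit : ∀ m → Ł L m → Set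
  IsBit m x = Σ (Ł L 1) λ b → embŁ m b ≡ x

  IsBit-resp : ∀ {m x y} → x ≡ y → IsBit m x → IsBit m y
  IsBit-resp x≡y (b , eb≡x) = b , trans eb≡x x≡y

  IsBit-negŁ : ∀ m {x} → IsBit m x → IsBit m (negŁ L m x)
  IsBit-negŁ m (b , eb≡x) = negŁ L 1 b , trans (embŁ-negŁ m b) (cong (negŁ L m) eb≡x)

  IsBit-impŁ : ∀ m {x y} → IsBit m x → IsBit m y → IsBit m (impŁ L m x y)
  IsBit-impŁ m (b , eb≡x) (c , ec≡y) =
    impŁ L 1 b c , trans (embŁ-impŁ m b c) (cong₂ (impŁ L m) eb≡x ec≡y)

  IsBit-maxF : ∀ m {n} {g : Fin n → Ł L m} → (∀ j → IsBit m (g j)) → IsBit m (maxF L m n g)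
  IsBit-maxF m {n} bits =
    maxF L 1 n (proj₁ ∘ bits) , trans (embŁ-maxF m n _) (maxF-cong m n (proj₂ ∘ bits))

  IsBit-IsInf : ∀ m {A} {P : A → Set} {f : A → Ł L m} {v} →
                IsInf L m P f v → (∀ a → P a → IsBit m (f a)) → IsBit m v
  IsBit-IsInf m {v = Fin.zero}    _           _    = botŁ L 1 , refl
  IsBit-IsInf m {v = Fin.suc j} (v≤f , glb) bits =
    topŁ L 1 , Finₚ.≤-antisym (glb (topŁ L m) (λ a p → top≤ (bits a p) (v≤f a p))) (≤fromℕ _)
    where
    top≤ : ∀ {y} → IsBit m y → Fin.suc j Fin.≤ y → topŁ L m Fin.≤ y
    top≤ (Fin.suc Fin.zero , refl) _ = ≤-refl

  module _ {m} {F : Frame L} (M : Model L m F) where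
    open Model M

    toℕ-Val-¬ : ∀ u φ → toℕ (Val u (¬f φ)) ≡ m ∸ toℕ (Val u φ)
    toℕ-Val-¬ u φ = trans (cong toℕ (v-¬ u φ)) (toℕ-negŁ m (Val u φ))

    toℕ-Val-⊙ : ∀ u φ ψ → toℕ (Val u (_⊙_ L φ ψ)) ≡ toℕ (Val u φ) + toℕ (Val u ψ) ∸ m
    toℕ-Val-⊙ u φ ψ = begin
      toℕ (Val u (¬f ((¬f (¬f φ)) ⇒ (¬f ψ))))
        ≡⟨ toℕ-Val-¬ u _ ⟩
      m ∸ toℕ (Val u ((¬f (¬f φ)) ⇒ (¬f ψ)))
        ≡⟨ cong (λ z → m ∸ toℕ z) (v-⇒ u _ _) ⟩
      m ∸ toℕ (impŁ L m (Val u (¬f (¬f φ))) (Val u (¬f ψ)))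
        ≡⟨ cong (m ∸_) (toℕ-impŁ m (Val u (¬f (¬f φ))) (Val u (¬f ψ))) ⟩
      m ∸ (m ⊓ ((m ∸ toℕ (Val u (¬f (¬f φ)))) + toℕ (Val u (¬f ψ))))
        ≡⟨ cong₂ (λ a b → m ∸ (m ⊓ (a + b))) m∸¬¬φ≡m∸φ (toℕ-Val-¬ u ψ) ⟩
      m ∸ (m ⊓ ((m ∸ toℕ (Val u φ)) + (m ∸ toℕ (Val u ψ))))
        ≡⟨ łukasiewicz-⊙ (toℕ≤pred[n] (Val u φ)) (toℕ≤pred[n] (Val u ψ)) ⟩
      toℕ (Val u φ) + toℕ (Val u ψ) ∸ m
        ∎
      where
      open ≡-Reasoning
      m∸¬¬φ≡m∸φ : m ∸ toℕ (Val u (¬f (¬f φ))) ≡ m ∸ toℕ (Val u φ)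
      m∸¬¬φ≡m∸φ = begin
        m ∸ toℕ (Val u (¬f (¬f φ)))      ≡⟨ cong (m ∸_) (toℕ-Val-¬ u (¬f φ)) ⟩
        m ∸ (m ∸ toℕ (Val u (¬f φ)))   ≡⟨ m∸[m∸n]≡n (toℕ≤pred[n] (Val u (¬f φ))) ⟩
        toℕ (Val u (¬f φ))             ≡⟨ toℕ-Val-¬ u φ ⟩
        m ∸ toℕ (Val u φ)              ∎

    Val-pow-top : ∀ u φ → toℕ (Val u φ) ≡ m → ∀ n → toℕ (Val u (pow L φ (suc n))) ≡ m
    Val-pow-top u φ φ≡m zero    = φ≡m
    Val-pow-top u φ φ≡m (suc n) = begin
      toℕ (Val u (_⊙_ L φ (pow L φ (suc n))))
        ≡⟨ toℕ-Val-⊙ u φ _ ⟩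
      toℕ (Val u φ) + toℕ (Val u (pow L φ (suc n))) ∸ m
        ≡⟨ cong₂ (λ a b → a + b ∸ m) φ≡m (Val-pow-top u φ φ≡m n) ⟩
      m + m ∸ m
        ≡⟨ m+n∸m≡n m m ⟩
      m ∎
      where open ≡-Reasoning

    Val-pow-below : ∀ u φ → toℕ (Val u φ) < m → ∀ n → toℕ (Val u (pow L φ (suc n))) ≤ pred m ∸ n
    Val-pow-below u φ φ<m zero    = <⇒≤pred φ<m
    Val-pow-below u φ φ<m (suc n) = begin
      toℕ (Val u (_⊙_ L φ (pow L φ (suc n))))
        ≡⟨ toℕ-Val-⊙ u φ _ ⟩
      toℕ (Val u φ) + toℕ (Val u (pow L φ (suc n))) ∸ m
        ≤⟨ m<o⇒m+n∸o≤pred[n] φ<m ⟩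
      pred (toℕ (Val u (pow L φ (suc n))))
        ≤⟨ pred-mono-≤ (Val-pow-below u φ φ<m n) ⟩
      pred (pred m ∸ n)
        ≡⟨ pred[m∸n]≡m∸[1+n] (pred m) n ⟩
      pred m ∸ suc n ∎
      where open ≤-Reasoning

    Val-pow : ∀ u φ n → m ≤ suc n → Val u (pow L φ (suc n)) ≡ embŁ m (isTopŁ m (Val u φ))
    Val-pow u φ n m≤1+n with toℕ (Val u φ) ℕ.≟ m
    ... | yes φ≡m = toℕ-injective (trans (Val-pow-top u φ φ≡m n) (sym (toℕ-fromℕ m)))
    ... | no  φ≢m = toℕ-injective (n≤0⇒n≡0 (begin
      toℕ (Val u (pow L φ (suc n))) ≤⟨ Val-pow-below u φ φ<m n ⟩
      pred m ∸ n                    ≡⟨ m≤n⇒m∸n≡0 (pred-mono-≤ m≤1+n) ⟩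
      0                             ∎))
      where
      open ≤-Reasoning
      φ<m : toℕ (Val u φ) < m
      φ<m = ≤∧≢⇒< (toℕ≤pred[n] (Val u φ)) φ≢m

  module _ {F : Frame L} (M : Model L 1 F) where
    open Model M

    Val-tr : ∀ n φ u → Val u (tr L (suc n) φ) ≡ Val u φ
    Val-tr n (var p) u = trans (Val-pow M u (var p) n (s≤s z≤n)) (embŁ-isTopŁ (Val u (var p)))
    Val-tr n ⊥f      u = refl
    Val-tr n (¬f φ)  u = trans (v-¬ u _) (trans (cong (negŁ L 1) (Val-tr n φ u)) (sym (v-¬ u φ)))
    Val-tr n (φ ⇒ ψ) u =
      trans (v-⇒ u _ _) (trans (cong₂ (impŁ L 1) (Val-tr n φ u) (Val-tr n ψ u)) (sym (v-⇒ u φ ψ)))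
    Val-tr n (∇ i φs) u = IsInf-unique
      (IsInf-cong (λ w → maxF-cong 1 _ (λ ℓ → Val-tr n (φs ℓ) (w ℓ))) refl (v-∇ u i _))
      (v-∇ u i φs)

  embModel : ∀ m {F} → Model L 1 F → Model L m F
  embModel m M = record
    { Val = λ u φ → embŁ m (Val u φ)
    ; v-⊥ = λ u → cong (embŁ m) (v-⊥ u)
    ; v-¬ = λ u φ → trans (cong (embŁ m) (v-¬ u φ)) (embŁ-negŁ m (Val u φ))
    ; v-⇒ = λ u φ ψ → trans (cong (embŁ m) (v-⇒ u φ ψ)) (embŁ-impŁ m (Val u φ) (Val u ψ))
    ; v-∇ = λ u i φs → IsInf-cong (λ w → embŁ-maxF m _ (λ ℓ → Val (w ℓ) (φs ℓ))) refl
                                  (IsInf-embŁ m (v-∇ u i φs))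
    }
    where open Model M

  module _ (k : ℕ) {F : Frame L} (M : Model L (suc k) F) where
    open Model M

    IsBit-Val-tr : ∀ φ u → IsBit (suc k) (Val u (tr L (suc k) φ))
    IsBit-Val-tr (var p) u = isTopŁ (suc k) (Val u (var p)) , sym (Val-pow M u (var p) k ≤-refl)
    IsBit-Val-tr ⊥f      u = botŁ L 1 , sym (v-⊥ u)
    IsBit-Val-tr (¬f φ)  u = IsBit-resp (sym (v-¬ u _)) (IsBit-negŁ (suc k) (IsBit-Val-tr φ u))
    IsBit-Val-tr (φ ⇒ ψ) u =
      IsBit-resp (sym (v-⇒ u _ _)) (IsBit-impŁ (suc k) (IsBit-Val-tr φ u) (IsBit-Val-tr ψ u))
    IsBit-Val-tr (∇ i φs) u =
      IsBit-IsInf (suc k) (v-∇ u i _) (λ w _ → IsBit-maxF (suc k) (λ ℓ → IsBit-Val-tr (φs ℓ) (w ℓ)))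

    -- The Ł₁-value of φ is the bit witnessing IsBit-Val-tr φ, which is built
    -- structurally, so the clauses for ⊥f, ¬f and ⇒ hold by computation.
    bitModel : Model L 1 F
    bitModel = record
      { Val = λ u φ → proj₁ (IsBit-Val-tr φ u)
      ; v-⊥ = λ _ → refl
      ; v-¬ = λ _ _ → refl
      ; v-⇒ = λ _ _ _ → refl
      ; v-∇ = λ u i φs → IsInf-embŁ⁻¹ k (IsInf-cong
          (λ w → sym (proj₂ (IsBit-maxF (suc k) (λ ℓ → IsBit-Val-tr (φs ℓ) (w ℓ)))))
          (sym (proj₂ (IsBit-Val-tr (∇ i φs) u)))
          (v-∇ u i _))
      }

  Valid⇒Valid₁ : ∀ k {F} φ → Valid L (suc k) F φ → Valid L 1 F φ
  Valid⇒Valid₁ k φ valid M u = embŁ-injective k (valid (embModel (suc k) M) u)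

  Valid-tr⇒Valid₁ : ∀ k {F} φ → Valid L (suc k) F (tr L (suc k) φ) → Valid L 1 F φ
  Valid-tr⇒Valid₁ k φ valid M u =
    trans (sym (Val-tr M k φ u)) (Valid⇒Valid₁ k (tr L (suc k) φ) valid M u)

  Valid₁⇒Valid-tr : ∀ k {F} φ → Valid L 1 F φ → Valid L (suc k) F (tr L (suc k) φ)
  Valid₁⇒Valid-tr k φ valid M u =
    trans (sym (proj₂ (IsBit-Val-tr k M φ u))) (cong (embŁ (suc k)) (valid (bitModel k M) u))

  Mod⊆Mod₁ : ∀ Φ m → m > 0 → (F : Frame L) → Mod L m Φ F → Mod L 1 Φ F
  Mod⊆Mod₁ Φ (suc k) _ F valid φ φ∈Φ = Valid⇒Valid₁ k φ (valid φ φ∈Φ)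

  Mod-trSet⇔Mod₁ : ∀ Φ m → m > 0 → (F : Frame L) → Mod L m (trSet L m Φ) F ⇔ Mod L 1 Φ F
  Mod-trSet⇔Mod₁ Φ (suc k) _ F = mk⇔
    (λ valid φ φ∈Φ → Valid-tr⇒Valid₁ k φ (valid _ (φ , φ∈Φ , refl)))
    (λ { valid _ (φ , φ∈Φ , refl) → Valid₁⇒Valid-tr k φ (valid φ φ∈Φ) })

  ≐-respʳ : ∀ {ℓ} {C : Frame L → Set ℓ} {D E : Frame L → Set} →
            _≐_ L C D → (∀ F → D F ⇔ E F) → _≐_ L C E
  ≐-respʳ C≐D D⇔E F =
    Equivalence.to (D⇔E F) ∘ proj₁ (C≐D F) , proj₂ (C≐D F) ∘ Equivalence.from (D⇔E F)

proposition2p5 : {ℓ : Level} (L : Lang) (C : Frame L → Set ℓ) (Φ : Form L → Set) →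
    ((_≐_ L C (Mod L 1 Φ)) ⇔ Σ ℕ (λ m → (m > 0) × (_≐_ L C (Mod L m (trSet L m Φ))))) ×
    ((_≐_ L C (Mod L 1 Φ)) ⇔ ((m : ℕ) → m > 0 → _≐_ L C (Mod L m (trSet L m Φ)))) ×
    ((m : ℕ) → m > 0 → (F : Frame L) → Mod L m Φ F → Mod L 1 Φ F)
proposition2p5 L C Φ = mk⇔ i⇒ii ii⇒i , mk⇔ i⇒iii iii⇒i , Mod⊆Mod₁ L Φ
  where
  i⇒iii : _≐_ L C (Mod L 1 Φ) → (m : ℕ) → m > 0 → _≐_ L C (Mod L m (trSet L m Φ))
  i⇒iii C≐Mod₁ m m>0 = ≐-respʳ L C≐Mod₁ (⇔-sym ∘ Mod-trSet⇔Mod₁ L Φ m m>0)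

  ii⇒i : Σ ℕ (λ m → (m > 0) × (_≐_ L C (Mod L m (trSet L m Φ)))) → _≐_ L C (Mod L 1 Φ)
  ii⇒i (m , m>0 , C≐Modₘ) = ≐-respʳ L C≐Modₘ (Mod-trSet⇔Mod₁ L Φ m m>0)

  i⇒ii : _≐_ L C (Mod L 1 Φ) → Σ ℕ (λ m → (m > 0) × (_≐_ L C (Mod L m (trSet L m Φ))))
  i⇒ii C≐Mod₁ = 1 , z<s , i⇒iii C≐Mod₁ 1 z<s

  iii⇒i : ((m : ℕ) → m > 0 → _≐_ L C (Mod L m (trSet L m Φ))) → _≐_ L C (Mod L 1 Φ)
  iii⇒i C≐Modₘ = ii⇒i (1 , z<s , C≐Modₘ 1 z<s)
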